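{- Every colourability sink $w\neq\varepsilon$ is colourable.
   Context: $\#w$ is the length, $\varepsilon$ the empty string; for $\#w\ge1$, $l(w)$ is $w$ without its last letter and $r(w)$ is $w$ without its first letter. $T^n$ is the alternating string of length $n$ starting with $0$ ($T^0=\varepsilon$, $T^n=T^{n-1}0$ for odd $n$, $T^n=T^{n-1}1$ for even $n\ge2$) and $CT^n$ its letterwise complement. $\xi$: $\xi(\varepsilon)=0$; $\xi(w)=1$ if $w=T^k$, $k\ge2$ even; $\xi(w)=-1$ if $w=CT^k$, $k\ge2$ even; otherwise $\xi(w)=\operatorname{sgn}(\xi(l(w))+\xi(r(w)))$. $\phi$: $\phi(\varepsilon)=0$; $\phi(w)=-1$ if $w=0^k$, $k$ odd; $\phi(w)=1$ if $w=1^k$, $k$ odd; otherwise $\phi(w)=\operatorname{sgn}(\phi(r(w))-\phi(l(w)))$. $\psi(w)=\xi(w)^{\#w}\phi(w)$ (with $0^0=1$); $w$ is colourable iff $\psi(w)\ne0$. A string $w$ is a colourability sink if neither $w0$ nor $w1$ is colourable. -}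

module Defs where

open import Data.Bool using (Bool; true; false; not; if_then_else_; _∧_)
open import Data.Nat using (ℕ; zero; suc)
open import Data.Integer using (ℤ; +_; -[1+_]; _+_; _-_; _*_; _^_; 0ℤ; 1ℤ; -1ℤ)
open import Data.List using (List; []; _∷_; _++_; [_]; length; map)
open import Data.List.Properties using (≡-dec)
import Data.Bool.Properties as BP
open import Relation.Nullary.Decidable using (⌊_⌋)
open import Relation.Binary.PropositionalEquality using (_≡_)
open import Relation.Nullary using (¬_)
open import Data.Product using (_×_)

-- Letters: false = 0, true = 1.  Strings are lists of letters.
Word : Set
Word = List Bool

l : Word → Word
l []           = []
l (x ∷ [])     = []
l (x ∷ y ∷ ys) = x ∷ l (y ∷ ys)

r : Word → Word
r []       = []
r (x ∷ xs) = xs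

isEven : ℕ → Bool
isEven zero    = true
isEven (suc n) = not (isEven n)

isOdd : ℕ → Bool
isOdd n = not (isEven n)

T : ℕ → Word
T zero    = []
T (suc n) = T n ++ [ (if isOdd (suc n) then false else true) ]

C : Word → Word
C = map not

CT : ℕ → Word
CT n = C (T n)

_=w_ : Word → Word → Bool
u =w v = ⌊ ≡-dec BP._≟_ u v ⌋

evenAtLeast2 : ℕ → Bool
evenAtLeast2 zero          = false
evenAtLeast2 (suc zero)    = false
evenAtLeast2 (suc (suc k)) = isEven k

sgn : ℤ → ℤ
sgn (+ zero)    = 0ℤ
sgn (+ (suc _)) = 1ℤ
sgn -[1+ _ ]    = -1ℤ

-- ξ and φ, defined by recursion on a fuel argument equal to the length
-- (l w and r w have length #w - 1).
ξ-aux : ℕ → Word → ℤ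
ξ-aux _ [] = 0ℤ
ξ-aux zero (_ ∷ _) = 0ℤ   -- unreachable when fuel = length
ξ-aux (suc n) w =
  if evenAtLeast2 (length w) ∧ (w =w T (length w)) then 1ℤ
  else if evenAtLeast2 (length w) ∧ (w =w CT (length w)) then -1ℤ
  else sgn (ξ-aux n (l w) + ξ-aux n (r w))

ξ : Word → ℤ
ξ w = ξ-aux (length w) w

allZero : Word → Bool
allZero []       = true
allZero (b ∷ bs) = not b ∧ allZero bs

allOne : Word → Bool
allOne []       = true
allOne (b ∷ bs) = b ∧ allOne bs

φ-aux : ℕ → Word → ℤ
φ-aux _ [] = 0ℤ
φ-aux zero (_ ∷ _) = 0ℤ   -- unreachable when fuel = length
φ-aux (suc n) w =
  if isOdd (length w) ∧ allZero w then -1ℤ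
  else if isOdd (length w) ∧ allOne w then 1ℤ
  else sgn (φ-aux n (r w) - φ-aux n (l w))

φ : Word → ℤ
φ w = φ-aux (length w) w

-- ψ(w) = ξ(w)^{#w} φ(w), with 0^0 = 1 (as in Data.Integer._^_)
ψ : Word → ℤ
ψ w = (ξ w ^ length w) * φ w

Colourable : Word → Set
Colourable w = ¬ (ψ w ≡ 0ℤ)

ColourabilitySink : Word → Set
ColourabilitySink w = ¬ Colourable (w ++ [ false ]) × ¬ Colourable (w ++ [ true ])

-- ξ(w) and φ(w) depend only on ξ and φ of l(w) and r(w) and on whether w is one of T^k, CT^k
-- (k even) or 0^k, 1^k (k odd). Whether w alternates from 0 or from 1, whether it is constant 0
-- or 1, and the parity of #w are in turn determined by the same data for l(w) and r(w). So the
-- profile (shape, ξ, φ) of w is obtained by glueing the profiles of l(w) and r(w), and the window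
-- of w (the profiles of w, l(w), r(w), l(l(w)), r(l(w)), r(r(w)), w0 and w1) by merging the
-- windows of l(w) and r(w), which overlap. The closure of the two one-letter windows under
-- merging overlapping windows is a list of 158 windows, so it contains the window of every
-- nonempty word; evaluation shows that in each of them, if neither w0 nor w1 has ξ and φ both
-- nonzero, then w has, and for nonempty w this makes ψ(w) nonzero.
module Submission where

open import Defs
open import Data.List using ([])
open import Relation.Binary.PropositionalEquality using (_≡_)
open import Relation.Nullary using (¬_)

open import Data.Bool using (Bool; true; false; not; _∧_; if_then_else_)
import Data.Bool
open import Data.Bool.ListAction using (any)
import Data.Bool.Properties as Bool
open import Data.Bool.Properties using (T-∧)
open import Data.Empty using (⊥-elim)
open import Data.Integer using (ℤ; _+_; _-_; _^_; 0ℤ; 1ℤ; -1ℤ)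
import Data.Integer.Properties as ℤ
open import Data.List using (List; _∷_; _++_; [_]; length; map; filter; foldr; cartesianProduct; iterate)
open import Data.List.Membership.Propositional using (_∈_)
open import Data.List.Membership.Propositional.Properties using (∈-map⁺; ∈-filter⁺; ∈-cartesianProduct⁺)
open import Data.List.Properties using (≡-dec)
open import Data.List.Relation.Binary.Subset.Propositional using (_⊆_)
open import Data.List.Relation.Unary.All using (all?)
import Data.List.Relation.Unary.All as All
open import Data.List.Relation.Unary.Any using (here; there)
open import Data.Nat using (ℕ; zero; suc; _≤_; _<_; s≤s)
import Data.Nat as ℕ
import Data.Nat.GeneralisedArithmetic as ℕ
open import Data.Nat.Induction using (<-wellFounded)
open import Data.Nat.Properties using (≤-refl; ≤-reflexive; m≤n⇒m≤1+n; n≮n; ≡ᵇ⇒≡)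
open import Data.Product using (_×_; _,_; uncurry)
open import Data.Sum using (_⊎_; inj₁; inj₂)
open import Function using (id; _∘_)
open import Function.Bundles using (module Equivalence)
import Induction.WellFounded as WF
open import Relation.Binary using (DecidableEquality; Decidable)
open import Relation.Binary.Construct.On as On using ()
open import Relation.Binary.PropositionalEquality using (refl; sym; trans; cong; cong₂; subst; module ≡-Reasoning)
open import Relation.Nullary using (Dec; does; yes; no; ¬?; _×-dec_; _→-dec_)
open import Relation.Nullary.Decidable using (map′; isYes; isYes≗does; toWitness)

module Saturation {A : Set} (_≟_ : DecidableEquality A)
                  {Compatible : A → A → Set} (compatible? : Decidable Compatible)
                  (merge : A → A → A) where

  isIn : A → List A → Bool
  isIn a = any (λ b → does (a ≟ b))

  insert : A → List A → List A
  insert a xs = if isIn a xs then xs else a ∷ xs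

  merges : List A → List A
  merges xs = map (uncurry merge) (filter (uncurry compatible?) (cartesianProduct xs xs))

  grow : List A → List A
  grow xs = foldr insert xs (merges xs)

  saturate : ℕ → List A → List A
  saturate zero    xs = xs
  saturate (suc n) xs = saturate n (grow xs)

  Closed : List A → Set
  Closed xs = ∀ {a b} → a ∈ xs → b ∈ xs → Compatible a b → merge a b ∈ xs

  isIn⇒∈ : ∀ a xs → Data.Bool.T (isIn a xs) → a ∈ xs
  isIn⇒∈ a (x ∷ xs) t with a ≟ x
  ... | yes refl = here refl
  ... | no _     = there (isIn⇒∈ a xs t)

  insert-cases : ∀ a xs → (a ∈ xs × insert a xs ≡ xs) ⊎ insert a xs ≡ a ∷ xs
  insert-cases a xs with isIn a xs | isIn⇒∈ a xs
  ... | true  | a∈xs = inj₁ (a∈xs _ , refl)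
  ... | false | _    = inj₂ refl

  ∈-insert : ∀ a xs → a ∈ insert a xs
  ∈-insert a xs with insert a xs | insert-cases a xs
  ... | _ | inj₁ (a∈xs , refl) = a∈xs
  ... | _ | inj₂ refl          = here refl

  ⊆-insert : ∀ a xs → xs ⊆ insert a xs
  ⊆-insert a xs with insert a xs | insert-cases a xs
  ... | _ | inj₁ (_ , refl) = id
  ... | _ | inj₂ refl       = there

  ∈-foldr-insert : ∀ xs {c cs} → c ∈ cs → c ∈ foldr insert xs cs
  ∈-foldr-insert xs {cs = c ∷ cs} (here refl)  = ∈-insert c (foldr insert xs cs)
  ∈-foldr-insert xs {cs = c ∷ cs} (there c∈cs) = ⊆-insert c (foldr insert xs cs) (∈-foldr-insert xs c∈cs)

  length-foldr-insert : ∀ xs cs → length xs ≤ length (foldr insert xs cs)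
  length-foldr-insert xs []       = ≤-refl
  length-foldr-insert xs (c ∷ cs) with insert c (foldr insert xs cs) | insert-cases c (foldr insert xs cs)
  ... | _ | inj₁ (_ , refl) = length-foldr-insert xs cs
  ... | _ | inj₂ refl       = m≤n⇒m≤1+n (length-foldr-insert xs cs)

  foldr-insert-stable : ∀ xs cs → length (foldr insert xs cs) ≡ length xs → foldr insert xs cs ≡ xs
  foldr-insert-stable xs []       _ = refl
  foldr-insert-stable xs (c ∷ cs) eq with insert c (foldr insert xs cs) | insert-cases c (foldr insert xs cs)
  ... | _ | inj₁ (_ , refl) = foldr-insert-stable xs cs eq
  ... | _ | inj₂ refl       = ⊥-elim (n≮n n (subst (_≤ n) (sym eq) (length-foldr-insert xs cs)))
    where n = length (foldr insert xs cs)

  ∈-merges : ∀ {xs a b} → a ∈ xs → b ∈ xs → Compatible a b → merge a b ∈ merges xs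
  ∈-merges a∈xs b∈xs ab = ∈-map⁺ (uncurry merge) (∈-filter⁺ (uncurry compatible?) (∈-cartesianProduct⁺ a∈xs b∈xs) ab)

  isFixpoint : List A → Bool
  isFixpoint xs = length (grow xs) ℕ.≡ᵇ length xs

  isFixpoint⇒closed : ∀ xs → Data.Bool.T (isFixpoint xs) → Closed xs
  isFixpoint⇒closed xs fix a∈xs b∈xs ab =
    subst (_ ∈_) (foldr-insert-stable xs (merges xs) (≡ᵇ⇒≡ _ _ fix)) (∈-foldr-insert xs (∈-merges a∈xs b∈xs ab))

length-l : ∀ x xs → length (l (x ∷ xs)) ≡ length xs
length-l x []       = refl
length-l x (y ∷ ys) = cong suc (length-l y ys)

l-++ : ∀ w b → l (w ++ [ b ]) ≡ w
l-++ []           b = refl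
l-++ (x ∷ [])     b = refl
l-++ (x ∷ y ∷ ys) b = cong (x ∷_) (l-++ (y ∷ ys) b)

r-l-comm : ∀ w → r (l w) ≡ l (r w)
r-l-comm []           = refl
r-l-comm (x ∷ [])     = refl
r-l-comm (x ∷ y ∷ ys) = refl

lr-induction : (P : Word → Set) → (∀ x → P (x ∷ [])) →
               (∀ x y ys → P (l (x ∷ y ∷ ys)) → P (y ∷ ys) → P (x ∷ y ∷ ys)) →
               ∀ w → ¬ (w ≡ []) → P w
lr-induction P base step = WF.All.wfRec (On.wellFounded length <-wellFounded) _ Q rec
  where
  Q : Word → Set
  Q w = ¬ (w ≡ []) → P w
  rec : ∀ w → WF.WfRec (λ u v → length u < length v) Q w → Q w
  rec []           _  w≢[] = ⊥-elim (w≢[] refl)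
  rec (x ∷ [])     _  _    = base x
  rec (x ∷ y ∷ ys) ih _    =
    step x y ys (ih (s≤s (s≤s (≤-reflexive (length-l y ys)))) λ ()) (ih ≤-refl λ ())

isIterate : (Bool → Bool) → Bool → Word → Bool
isIterate σ b []      = true
isIterate σ b (x ∷ w) = does (x Bool.≟ b) ∧ isIterate σ (σ b) w

isIterate-l : ∀ σ b w → isIterate σ b w ≡ isIterate σ b (l w) ∧ isIterate σ b w
isIterate-l σ b []           = refl
isIterate-l σ b (x ∷ [])     = refl
isIterate-l σ b (x ∷ y ∷ ys) =
  trans (cong (p ∧_) (isIterate-l σ (σ b) (y ∷ ys))) (∧-absorb p _ _)
  where
  p = does (x Bool.≟ b)
  ∧-absorb : ∀ p u v → p ∧ (u ∧ v) ≡ (p ∧ u) ∧ (p ∧ v)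
  ∧-absorb true  u v = refl
  ∧-absorb false u v = refl

isIterate-step : ∀ σ b x y ys →
                 isIterate σ b (x ∷ y ∷ ys) ≡ isIterate σ b (l (x ∷ y ∷ ys)) ∧ isIterate σ (σ b) (y ∷ ys)
isIterate-step σ b x y ys = begin
  p ∧ q             ≡⟨ cong (p ∧_) (isIterate-l σ (σ b) (y ∷ ys)) ⟩
  p ∧ (q′ ∧ q)      ≡⟨ sym (Bool.∧-assoc p q′ q) ⟩
  (p ∧ q′) ∧ q      ∎
  where
  open ≡-Reasoning
  p  = does (x Bool.≟ b)
  q  = isIterate σ (σ b) (y ∷ ys)
  q′ = isIterate σ (σ b) (l (y ∷ ys))

=w-iterate : ∀ σ b w → (w =w iterate σ b (length w)) ≡ isIterate σ b w
=w-iterate σ b w = trans (isYes≗does _) (does-≡ σ b w)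
  where
  does-≡ : ∀ σ b w → does (≡-dec Bool._≟_ w (iterate σ b (length w))) ≡ isIterate σ b w
  does-≡ σ b []      = refl
  does-≡ σ b (x ∷ w) = cong (does (x Bool.≟ b) ∧_) (does-≡ σ (σ b) w)

iterate-snoc : ∀ (σ : Bool → Bool) b n → iterate σ b (suc n) ≡ iterate σ b n ++ [ ℕ.iterate σ b n ]
iterate-snoc σ b zero    = refl
iterate-snoc σ b (suc n) = cong (b ∷_) (iterate-snoc σ (σ b) n)

iterate-not : ∀ b n → ℕ.iterate not b n ≡ (if isEven n then b else not b)
iterate-not b zero = refl
iterate-not b (suc n) with isEven n | iterate-not (not b) n
... | true  | eq = eq
... | false | eq = trans eq (Bool.not-involutive b)

T-iterate : ∀ n → T n ≡ iterate not false n
T-iterate zero    = refl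
T-iterate (suc n) = begin
  T n ++ [ if isOdd (suc n) then false else true ]   ≡⟨ cong₂ (λ u c → u ++ [ c ]) (T-iterate n) last-letter ⟩
  iterate not false n ++ [ ℕ.iterate not false n ]   ≡⟨ sym (iterate-snoc not false n) ⟩
  iterate not false (suc n)                          ∎
  where
  open ≡-Reasoning
  last-letter : (if isOdd (suc n) then false else true) ≡ ℕ.iterate not false n
  last-letter = trans (cong (λ e → if e then false else true) (Bool.not-involutive (isEven n)))
                      (sym (iterate-not false n))

CT-iterate : ∀ n → CT n ≡ iterate not true n
CT-iterate n = trans (cong (map not) (T-iterate n)) (map-not false n)
  where
  map-not : ∀ b n → map not (iterate not b n) ≡ iterate not (not b) n
  map-not b zero    = refl
  map-not b (suc n) = cong (not b ∷_) (map-not (not b) n)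

allZero-isIterate : ∀ w → allZero w ≡ isIterate id false w
allZero-isIterate []          = refl
allZero-isIterate (false ∷ w) = allZero-isIterate w
allZero-isIterate (true ∷ w)  = refl

allOne-isIterate : ∀ w → allOne w ≡ isIterate id true w
allOne-isIterate []          = refl
allOne-isIterate (true ∷ w)  = allOne-isIterate w
allOne-isIterate (false ∷ w) = refl

-- Without eta, matching in glueShape forces the shapes; this keeps the saturation below cheap
-- enough to be evaluated during type checking.
record Shape : Set where
  no-eta-equality
  pattern
  constructor shape⟨_,_,_,_,_⟩
  field
    alternating₀ alternating₁ constant₀ constant₁ evenLength : Bool

open Shape

shape : Word → Shape
shape w = shape⟨ isIterate not false w , isIterate not true w , isIterate id false w , isIterate id true w ,
                 isEven (length w) ⟩

glueShape : Shape → Shape → Shape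
glueShape shape⟨ a₀ , a₁ , c₀ , c₁ , _ ⟩ shape⟨ b₀ , b₁ , d₀ , d₁ , e ⟩ =
  shape⟨ a₀ ∧ b₁ , a₁ ∧ b₀ , c₀ ∧ d₀ , c₁ ∧ d₁ , not e ⟩

shape-step : ∀ x y ys → shape (x ∷ y ∷ ys) ≡ glueShape (shape (l (x ∷ y ∷ ys))) (shape (y ∷ ys))
shape-step x y ys =
  fields-≡ (isIterate-step not false x y ys) (isIterate-step not true x y ys)
           (isIterate-step id false x y ys) (isIterate-step id true x y ys)
  where
  fields-≡ : ∀ {a₀ a₁ c₀ c₁ b₀ b₁ d₀ d₁ e} → a₀ ≡ b₀ → a₁ ≡ b₁ → c₀ ≡ d₀ → c₁ ≡ d₁ →
             shape⟨ a₀ , a₁ , c₀ , c₁ , e ⟩ ≡ shape⟨ b₀ , b₁ , d₀ , d₁ , e ⟩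
  fields-≡ refl refl refl refl = refl

Profile : Set
Profile = Shape × ℤ × ℤ

profile : Word → Profile
profile w = shape w , ξ w , φ w

ξ-rule : Shape → ℤ → ℤ → ℤ
ξ-rule s i j =
  if evenLength s ∧ alternating₀ s then 1ℤ
  else if evenLength s ∧ alternating₁ s then -1ℤ
  else sgn (i + j)

φ-rule : Shape → ℤ → ℤ → ℤ
φ-rule s i j =
  if not (evenLength s) ∧ constant₀ s then -1ℤ
  else if not (evenLength s) ∧ constant₁ s then 1ℤ
  else sgn (j - i)

-- The helper binds the glued shape once, so that the three components share it.
glue : Profile → Profile → Profile
glue (s , i , p) (t , j , q) = glueAt (glueShape s t)
  where
  glueAt : Shape → Profile
  glueAt u = u , ξ-rule u i j , φ-rule u p q

ξ-step : ∀ x y ys → ξ (x ∷ y ∷ ys) ≡ ξ-rule (shape (x ∷ y ∷ ys)) (ξ (l (x ∷ y ∷ ys))) (ξ (y ∷ ys))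
ξ-step x y ys = begin
  ξ w                                       ≡⟨ cong (λ n → rule (ξ-aux n (l w))) (sym (length-l x (y ∷ ys))) ⟩
  rule (ξ (l w))                            ≡⟨ cong₂ (λ a b → if a then 1ℤ else if b then -1ℤ else sgn (ξ (l w) + ξ (y ∷ ys)))
                                                     (test-≡ not false (T-iterate (length w)))
                                                     (test-≡ not true (CT-iterate (length w))) ⟩
  ξ-rule (shape w) (ξ (l w)) (ξ (y ∷ ys))   ∎
  where
  open ≡-Reasoning
  w = x ∷ y ∷ ys
  rule : ℤ → ℤ
  rule i = if evenAtLeast2 (length w) ∧ (w =w T (length w)) then 1ℤ
           else if evenAtLeast2 (length w) ∧ (w =w CT (length w)) then -1ℤ
           else sgn (i + ξ (y ∷ ys))
  test-≡ : ∀ σ b {u} → u ≡ iterate σ b (length w) →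
           isEven (length ys) ∧ (w =w u) ≡ isEven (length w) ∧ isIterate σ b w
  test-≡ σ b refl = cong₂ _∧_ (sym (Bool.not-involutive (isEven (length ys)))) (=w-iterate σ b w)

φ-step : ∀ x y ys → φ (x ∷ y ∷ ys) ≡ φ-rule (shape (x ∷ y ∷ ys)) (φ (l (x ∷ y ∷ ys))) (φ (y ∷ ys))
φ-step x y ys = begin
  φ w               ≡⟨ cong (λ n → rule (φ-aux n (l w))) (sym (length-l x (y ∷ ys))) ⟩
  rule (φ (l w))    ≡⟨ cong₂ (λ a b → if odd ∧ a then -1ℤ else if odd ∧ b then 1ℤ else sgn (φ (y ∷ ys) - φ (l w)))
                             (allZero-isIterate w) (allOne-isIterate w) ⟩
  φ-rule (shape w) (φ (l w)) (φ (y ∷ ys))   ∎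
  where
  open ≡-Reasoning
  w = x ∷ y ∷ ys
  odd = isOdd (length w)
  rule : ℤ → ℤ
  rule i = if odd ∧ allZero w then -1ℤ else if odd ∧ allOne w then 1ℤ else sgn (φ (y ∷ ys) - i)

profile-step : ∀ x y ys → profile (x ∷ y ∷ ys) ≡ glue (profile (l (x ∷ y ∷ ys))) (profile (y ∷ ys))
profile-step x y ys = begin
  shape w , ξ w , φ w
    ≡⟨ cong₂ (λ i p → shape w , i , p) (ξ-step x y ys) (φ-step x y ys) ⟩
  shape w , ξ-rule (shape w) (ξ (l w)) (ξ (y ∷ ys)) , φ-rule (shape w) (φ (l w)) (φ (y ∷ ys))
    ≡⟨ cong (λ s → s , ξ-rule s (ξ (l w)) (ξ (y ∷ ys)) , φ-rule s (φ (l w)) (φ (y ∷ ys))) (shape-step x y ys) ⟩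
  glue (profile (l w)) (profile (y ∷ ys))   ∎
  where
  open ≡-Reasoning
  w = x ∷ y ∷ ys

record Window : Set where
  field
    whole left right leftLeft centre rightRight plus₀ plus₁ : Profile

open Window

window : Word → Window
window v = record
  { whole      = profile v
  ; left       = profile (l v)
  ; right      = profile (r v)
  ; leftLeft   = profile (l (l v))
  ; centre     = profile (r (l v))
  ; rightRight = profile (r (r v))
  ; plus₀      = profile (v ++ [ false ])
  ; plus₁      = profile (v ++ [ true ])
  }

Overlapping : Window → Window → Set
Overlapping X Y = right X ≡ left Y × centre X ≡ leftLeft Y × rightRight X ≡ centre Y

merge : Window → Window → Window
merge X Y = mergeAt (glue (whole X) (whole Y))
  where
  mergeAt : Profile → Window
  mergeAt p = record
    { whole      = p
    ; left       = whole X
    ; right      = whole Y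
    ; leftLeft   = left X
    ; centre     = right X
    ; rightRight = right Y
    ; plus₀      = glue p (plus₀ Y)
    ; plus₁      = glue p (plus₁ Y)
    }

window-overlap : ∀ v → Overlapping (window (l v)) (window (r v))
window-overlap v =
  cong profile (r-l-comm v) , cong profile (trans (r-l-comm (l v)) (cong l (r-l-comm v))) , cong (profile ∘ r) (r-l-comm v)

window-step : ∀ x y ys → window (x ∷ y ∷ ys) ≡ merge (window (l (x ∷ y ∷ ys))) (window (y ∷ ys))
window-step x y ys = begin
  window w
    ≡⟨ cong₂ (λ p₀ p₁ → record (window w) { plus₀ = p₀ ; plus₁ = p₁ }) (plus-step false) (plus-step true) ⟩
  record (window w) { plus₀ = glue (profile w) (profile (y ∷ ys ++ [ false ]))
                    ; plus₁ = glue (profile w) (profile (y ∷ ys ++ [ true ])) }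
    ≡⟨ cong (λ p → record (window w) { whole = p
                                     ; plus₀ = glue p (profile (y ∷ ys ++ [ false ]))
                                     ; plus₁ = glue p (profile (y ∷ ys ++ [ true ])) })
            (profile-step x y ys) ⟩
  merge (window (l w)) (window (y ∷ ys))   ∎
  where
  open ≡-Reasoning
  w = x ∷ y ∷ ys
  plus-step : ∀ b → profile (w ++ [ b ]) ≡ glue (profile w) (profile (y ∷ ys ++ [ b ]))
  plus-step b = trans (profile-step x y (ys ++ [ b ]))
                      (cong (λ u → glue (profile u) (profile (y ∷ ys ++ [ b ]))) (l-++ w b))

_≟ˢ_ : DecidableEquality Shape
shape⟨ a₀ , a₁ , c₀ , c₁ , e ⟩ ≟ˢ shape⟨ b₀ , b₁ , d₀ , d₁ , f ⟩ =
  map′ (λ { (refl , refl , refl , refl , refl) → refl }) (λ { refl → refl , refl , refl , refl , refl })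
       ((a₀ Bool.≟ b₀) ×-dec (a₁ Bool.≟ b₁) ×-dec (c₀ Bool.≟ d₀) ×-dec (c₁ Bool.≟ d₁) ×-dec (e Bool.≟ f))

_≟ᵖ_ : DecidableEquality Profile
(s , i , p) ≟ᵖ (t , j , q) =
  map′ (λ { (refl , refl , refl) → refl }) (λ { refl → refl , refl , refl })
       ((s ≟ˢ t) ×-dec (i ℤ.≟ j) ×-dec (p ℤ.≟ q))

_≟ʷ_ : DecidableEquality Window
X ≟ʷ Y = map′ code-injective (cong code) (≡-dec _≟ᵖ_ (code X) (code Y))
  where
  code : Window → List Profile
  code X = whole X ∷ left X ∷ right X ∷ leftLeft X ∷ centre X ∷ rightRight X ∷ plus₀ X ∷ plus₁ X ∷ []
  code-injective : code X ≡ code Y → X ≡ Y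
  code-injective refl = refl

overlapping? : Decidable Overlapping
overlapping? X Y = (right X ≟ᵖ left Y) ×-dec (centre X ≟ᵖ leftLeft Y) ×-dec (rightRight X ≟ᵖ centre Y)

open Saturation _≟ʷ_ overlapping? merge

windows-∈ : ∀ {R} → Closed R → window (false ∷ []) ∈ R → window (true ∷ []) ∈ R →
            ∀ v → ¬ (v ≡ []) → window v ∈ R
windows-∈ {R} closed 0∈R 1∈R = lr-induction (λ v → window v ∈ R) base step
  where
  base : ∀ x → window (x ∷ []) ∈ R
  base false = 0∈R
  base true  = 1∈R
  step : ∀ x y ys → window (l (x ∷ y ∷ ys)) ∈ R → window (y ∷ ys) ∈ R → window (x ∷ y ∷ ys) ∈ R
  step x y ys l∈R r∈R =
    subst (_∈ R) (sym (window-step x y ys)) (closed l∈R r∈R (window-overlap (x ∷ y ∷ ys)))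

Nonvanishing : Profile → Set
Nonvanishing (_ , i , p) = ¬ (i ≡ 0ℤ) × ¬ (p ≡ 0ℤ)

nonvanishing? : ∀ p → Dec (Nonvanishing p)
nonvanishing? (_ , i , p) = ¬? (i ℤ.≟ 0ℤ) ×-dec ¬? (p ℤ.≟ 0ℤ)

SinkRule : Window → Set
SinkRule X = ¬ Nonvanishing (plus₀ X) → ¬ Nonvanishing (plus₁ X) → Nonvanishing (whole X)

sinkRule? : ∀ X → Dec (SinkRule X)
sinkRule? X = ¬? (nonvanishing? (plus₀ X)) →-dec ¬? (nonvanishing? (plus₁ X)) →-dec nonvanishing? (whole X)

-- A single Boolean, so that checking it evaluates the saturation only once.
certified : List Window → Bool
certified R = isFixpoint R ∧ isIn (window (false ∷ [])) R ∧ isIn (window (true ∷ [])) R ∧ isYes (all? sinkRule? R)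

certified⇒sinkRule : ∀ R → Data.Bool.T (certified R) → ∀ v → ¬ (v ≡ []) → SinkRule (window v)
certified⇒sinkRule R c =
  let fixpoint , c₁ = split (isFixpoint R) _ c
      0∈R , c₂      = split (isIn (window (false ∷ [])) R) _ c₁
      1∈R , sink    = split (isIn (window (true ∷ [])) R) _ c₂
      closed        = isFixpoint⇒closed R fixpoint
  in  λ v v≢[] → All.lookup (toWitness sink) (windows-∈ closed (isIn⇒∈ _ R 0∈R) (isIn⇒∈ _ R 1∈R) v v≢[])
  where
  split : ∀ x y → Data.Bool.T (x ∧ y) → Data.Bool.T x × Data.Bool.T y
  split x y = Equivalence.to (T-∧ {x} {y})

-- Eight rounds of saturation reach the fixpoint.
sinkRule-window : ∀ v → ¬ (v ≡ []) → SinkRule (window v)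
sinkRule-window = certified⇒sinkRule (saturate 8 (window (false ∷ []) ∷ window (true ∷ []) ∷ [])) _

nonvanishing⇒colourable : ∀ w → Nonvanishing (profile w) → Colourable w
nonvanishing⇒colourable w (ξ≢0 , φ≢0) ψ≡0 with ℤ.i*j≡0⇒i≡0∨j≡0 (ξ w ^ length w) ψ≡0
... | inj₁ ξⁿ≡0 = ξ≢0 (ℤ.i^n≡0⇒i≡0 (ξ w) (length w) ξⁿ≡0)
... | inj₂ φ≡0  = φ≢0 φ≡0

lemma7p6 : (w : Word) → ¬ (w ≡ []) → ColourabilitySink w → Colourable w
lemma7p6 w w≢[] (w0-uncolourable , w1-uncolourable) =
  nonvanishing⇒colourable w
    (sinkRule-window w w≢[] (w0-uncolourable ∘ nonvanishing⇒colourable (w ++ [ false ]))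
                            (w1-uncolourable ∘ nonvanishing⇒colourable (w ++ [ true ])))
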